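{- Let $V$ be a vertex set partitioned as $V=\mathcal{P}\cup\mathcal{T}$ and let $t\in\mathcal{T}$. The graph search algorithm $\mathsf{SFS}(G,t)$ (described in the context), viewed as a function of the graph $G$ on $V$ whose output is the ordered list $\tilde T$, satisfies $0$-protected differential privacy; that is, for any two neighboring graphs $G,G'$ it produces the same output.
   Context: Graphs are undirected on fixed vertex set $V$ with fixed partition $V=\mathcal{P}\cup\mathcal{T}$. For a graph $G$ and vertex $v$, $D_v(G)$ is the set of edges incident to $v$. Graphs $G,G'$ are neighboring if there is $v\in\mathcal{P}$ such that $D_{u}(G)\cup\{(v,u)\}=D_{u}(G')\cup\{(v,u)\}$ for all $u\ne v$. An algorithm $\mathcal{A}$ satisfies $\varepsilon$-protected differential privacy if for all neighboring $G,G'$ and all output sets $S$, $\Pr[\mathcal{A}(G)\in S]\le e^{\varepsilon}\Pr[\mathcal{A}(G')\in S]$. The algorithm learns membership in $\mathcal{T}$ only through an oracle $\mathcal{I}(v)=1$ iff $v\in\mathcal{T}$. $\mathsf{Path}_1(G,x,\tilde T)$ is the number of edges between vertex $x$ and set $\tilde T$. Algorithm $\mathsf{SFS}(G,t)$: set $\tilde T=(t)$, $I=\{t\}$, $\mathcal{N}=$ neighbors of $t$; while $\mathcal{N}\setminus I\ne\emptyset$: let $v'=\arg\max_{x\in\mathcal{N}\setminus I}\mathsf{Path}_1(G,x,\tilde T)$ (ties broken by a fixed ordering of $V$), query $\mathcal{I}(v')$, add $v'$ to $I$, and if $\mathcal{I}(v')=1$ append $v'$ to $\tilde T$ and set $\mathcal{N}=$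 neighbors of $\tilde T$; output the list $\tilde T$. -}

module Defs where

open import Data.Nat using (ℕ; zero; suc; _<ᵇ_)
open import Data.Bool using (Bool; true; false; _∨_; not; if_then_else_)
open import Data.Fin using (Fin; _≟_)
open import Data.List using (List; []; _∷_; _++_; length; allFin)
open import Data.Bool.ListAction using (any)
open import Data.Product using (Σ-syntax; _×_)
open import Data.Maybe using (Maybe; just; nothing)
open import Relation.Nullary.Decidable using (⌊_⌋)
open import Relation.Binary.PropositionalEquality using (_≡_; _≢_)

-- Vertex set V = Fin n.  The partition V = P ∪ T is given by a Boolean
-- membership function  isT : Fin n → Bool  (isT v ≡ true iff v ∈ T);
-- this function is exactly the oracle I.

record Graph (n : ℕ) : Set where
  field
    adj   : Fin n → Fin n → Bool
    sym   : ∀ u w → adj u w ≡ adj w u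
    irref : ∀ u → adj u u ≡ false
open Graph public

filt : {A : Set} → (A → Bool) → List A → List A
filt p [] = []
filt p (x ∷ xs) = if p x then x ∷ filt p xs else filt p xs

memb : {n : ℕ} → Fin n → List (Fin n) → Bool
memb x = any (λ y → ⌊ x ≟ y ⌋)

-- D_u(G) ∪ {(v,u)}: an edge incident to u is identified with its other
-- endpoint w; the edge (u,w) belongs to D_u(G) ∪ {(v,u)} iff adj u w or w = v.
inDplus : {n : ℕ} → Graph n → (v u w : Fin n) → Bool
inDplus G v u w = adj G u w ∨ ⌊ w ≟ v ⌋

Neighboring : {n : ℕ} → (Fin n → Bool) → Graph n → Graph n → Set
Neighboring {n} isT G G' =
  Σ[ v ∈ Fin n ] (isT v ≡ false ×
    (∀ u → u ≢ v → ∀ w → inDplus G v u w ≡ inDplus G' v u w))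

-- Path_1(G, x, T̃): number of edges between x and the set T̃
-- (T̃ is always a duplicate-free list in SFS).
path1 : {n : ℕ} → Graph n → Fin n → List (Fin n) → ℕ
path1 G x T = length (filt (adj G x) T)

nbrs : {n : ℕ} → Graph n → List (Fin n) → List (Fin n)
nbrs {n} G T = filt (λ x → any (adj G x) T) (allFin n)

-- argmax of f over a list; among ties, the earliest element of the list wins.
argmaxFrom : {n : ℕ} → (Fin n → ℕ) → Fin n → List (Fin n) → Fin n
argmaxFrom f best [] = best
argmaxFrom f best (x ∷ xs) =
  if f best <ᵇ f x then argmaxFrom f x xs else argmaxFrom f best xs

argmax : {n : ℕ} → (Fin n → ℕ) → List (Fin n) → Maybe (Fin n)
argmax f [] = nothing
argmax f (x ∷ xs) = just (argmaxFrom f x xs)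

-- main loop of SFS with fuel; state = (T̃, I).  Each iteration adds a new
-- vertex to I, so n units of fuel suffice for the loop to terminate naturally.
sfsLoop : {n : ℕ} → (Fin n → Bool) → Graph n → ℕ → List (Fin n) → List (Fin n) → List (Fin n)
sfsLoop isT G zero T I = T
sfsLoop isT G (suc k) T I with argmax (λ x → path1 G x T) (filt (λ x → not (memb x I)) (nbrs G T))
... | nothing = T
... | just v' = if isT v' then sfsLoop isT G k (T ++ (v' ∷ [])) (v' ∷ I)
                          else sfsLoop isT G k T (v' ∷ I)

SFS : {n : ℕ} → (Fin n → Bool) → Graph n → Fin n → List (Fin n)
SFS {n} isT G t = sfsLoop isT G n (t ∷ []) (t ∷ [])

-- Let v ∈ P be the vertex at which G and G' differ.  The oracle answers 0 on v,
-- so whenever SFS picks v it only marks v as visited.  Deleting v from the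
-- candidate list never changes which other vertex the argmax picks, so running
-- SFS from a state with v unvisited gives the same output as running it from the
-- same state with v already visited (with one step less of fuel).  Once v is
-- visited it is never a candidate again, and since v never enters T̃, neither the
-- candidate lists nor the scores depend on edges at v: the runs on G and G' then
-- coincide step by step.

module Submission where

open import Defs hiding (sym)
open import Data.Nat using (ℕ; zero; suc; _≤_; _<_; _<ᵇ_; z≤n; s≤s)
open import Data.Nat.Properties
  using (≤-trans; ≤-reflexive; ≤-pred; <⇒≤; <⇒≱; <-irrefl; ≤-<-trans; m≤n⇒m≤1+n; <ᵇ⇒<; <⇒<ᵇ; ≮⇒≥)
open import Data.Bool using (Bool; true; false; _∨_; _∧_; not; if_then_else_; T)
open import Data.Bool.Properties using (∨-assoc; ∨-comm; ∨-zeroʳ; ∨-identityʳ; ∧-zeroʳ; not-involutive)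
open import Data.Bool.ListAction using (any)
open import Data.Fin using (Fin; _≟_)
open import Data.List using (List; []; _∷_; _++_; length; allFin)
open import Data.List.Properties using (length-tabulate)
open import Data.List.Relation.Unary.All as All using (All; []; _∷_)
open import Data.List.Relation.Unary.All.Properties using (++⁺)
open import Data.List.Relation.Unary.Any using (here; there)
open import Data.List.Membership.Propositional using (_∈_)
open import Data.List.Membership.Propositional.Properties using (∈-allFin)
open import Data.Maybe using (Maybe; just; nothing)
open import Data.Product using (_×_; _,_)
open import Function using (id)
open import Data.Sum using (_⊎_; inj₁; inj₂; map₁)
open import Data.Unit using (tt)
open import Relation.Nullary using (yes; no; contradiction)
open import Relation.Nullary.Decidable using (⌊_⌋; isYes≗does; dec-true; dec-false)
open import Relation.Binary.PropositionalEquality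
open ≡-Reasoning

⌊≟⌋-refl : ∀ {n} (x : Fin n) → ⌊ x ≟ x ⌋ ≡ true
⌊≟⌋-refl x = trans (isYes≗does (x ≟ x)) (dec-true (x ≟ x) refl)

⌊≟⌋-≢ : ∀ {n} {x y : Fin n} → x ≢ y → ⌊ x ≟ y ⌋ ≡ false
⌊≟⌋-≢ {x = x} {y} x≢y = trans (isYes≗does (x ≟ y)) (dec-false (x ≟ y) x≢y)

true≢false : true ≢ false
true≢false ()

not-∨ : ∀ a b → not (a ∨ b) ≡ not b ∧ not a
not-∨ false false = refl
not-∨ false true = refl
not-∨ true false = refl
not-∨ true true = refl

∨-leftComm : ∀ a b c → a ∨ (b ∨ c) ≡ b ∨ (a ∨ c)
∨-leftComm a b c = begin
  a ∨ (b ∨ c)  ≡⟨ ∨-assoc a b c ⟨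
  (a ∨ b) ∨ c  ≡⟨ cong (_∨ c) (∨-comm a b) ⟩
  (b ∨ a) ∨ c  ≡⟨ ∨-assoc b a c ⟩
  b ∨ (a ∨ c)  ∎

module _ {A : Set} where

  filt-∈ : (p : A → Bool) {w : A} (L : List A) → w ∈ filt p L → p w ≡ true
  filt-∈ p (x ∷ L) w∈ with p x in px
  filt-∈ p (x ∷ L) (here refl) | true = px
  filt-∈ p (x ∷ L) (there w∈) | true = filt-∈ p L w∈
  filt-∈ p (x ∷ L) w∈ | false = filt-∈ p L w∈

  filt-fusion : (p q : A → Bool) (L : List A) → filt p (filt q L) ≡ filt (λ x → q x ∧ p x) L
  filt-fusion p q [] = refl
  filt-fusion p q (x ∷ L) with q x
  ... | false = filt-fusion p q L
  ... | true with p x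
  ...   | true = cong (x ∷_) (filt-fusion p q L)
  ...   | false = filt-fusion p q L

  filt-cong : {p q : A → Bool} (L : List A) → All (λ x → p x ≡ q x) L → filt p L ≡ filt q L
  filt-cong [] [] = refl
  filt-cong {p} {q} (x ∷ L) (px≡qx ∷ eqs) =
    cong₂ (λ b ys → if b then x ∷ ys else ys) px≡qx (filt-cong L eqs)

  any-cong : {p q : A → Bool} (L : List A) → All (λ x → p x ≡ q x) L → any p L ≡ any q L
  any-cong [] [] = refl
  any-cong (x ∷ L) (px≡qx ∷ eqs) = cong₂ _∨_ px≡qx (any-cong L eqs)

  filt-length-≤ : (p : A → Bool) (L : List A) → length (filt p L) ≤ length L
  filt-length-≤ p [] = z≤n
  filt-length-≤ p (x ∷ L) with p x
  ... | true = s≤s (filt-length-≤ p L)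
  ... | false = m≤n⇒m≤1+n (filt-length-≤ p L)

  module _ (p q : A → Bool) (q⇒p : ∀ x → q x ≡ true → p x ≡ true) where

    filt-length-mono : (L : List A) → length (filt q L) ≤ length (filt p L)
    filt-length-mono [] = z≤n
    filt-length-mono (x ∷ L) with q x in qx | p x in px
    ... | true | true = s≤s (filt-length-mono L)
    ... | true | false = contradiction (trans (sym (q⇒p x qx)) px) true≢false
    ... | false | true = m≤n⇒m≤1+n (filt-length-mono L)
    ... | false | false = filt-length-mono L

    filt-length-< : ∀ {w} (L : List A) → w ∈ L → p w ≡ true → q w ≡ false →
                    length (filt q L) < length (filt p L)
    filt-length-< (x ∷ L) (here refl) pw qw rewrite pw | qw = s≤s (filt-length-mono L)
    filt-length-< (x ∷ L) (there w∈L) pw qw with q x in qx | p x in px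
    ... | true | true = s≤s (filt-length-< L w∈L pw qw)
    ... | true | false = contradiction (trans (sym (q⇒p x qx)) px) true≢false
    ... | false | true = m≤n⇒m≤1+n (filt-length-< L w∈L pw qw)
    ... | false | false = filt-length-< L w∈L pw qw

without : ∀ {n} → Fin n → List (Fin n) → List (Fin n)
without v = filt (λ x → not ⌊ x ≟ v ⌋)

module Argmax {n : ℕ} (f : Fin n → ℕ) where

  pick : Fin n → Fin n → Fin n
  pick b x = if f b <ᵇ f x then x else b

  argmaxFrom-∷ : ∀ b x xs → argmaxFrom f b (x ∷ xs) ≡ argmaxFrom f (pick b x) xs
  argmaxFrom-∷ b x xs with f b <ᵇ f x
  ... | true = refl
  ... | false = refl

  data PickView (b x : Fin n) : Set where
    picks-new : f b < f x → pick b x ≡ x → PickView b x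
    keeps-old : f x ≤ f b → pick b x ≡ b → PickView b x

  pick-view : ∀ b x → PickView b x
  pick-view b x with f b <ᵇ f x in lt
  ... | true = picks-new (<ᵇ⇒< (f b) (f x) (subst T (sym lt) tt)) (cong (if_then x else b) lt)
  ... | false = keeps-old (≮⇒≥ (λ b<x → subst T lt (<⇒<ᵇ b<x))) (cong (if_then x else b) lt)

  pick-< : ∀ {b x} → f b < f x → pick b x ≡ x
  pick-< {b} {x} b<x with pick-view b x
  ... | picks-new _ picked = picked
  ... | keeps-old x≤b _ = contradiction x≤b (<⇒≱ b<x)

  pick-self : ∀ b → pick b b ≡ b
  pick-self b with pick-view b b
  ... | picks-new b<b _ = contradiction b<b (<-irrefl refl)
  ... | keeps-old _ kept = kept

  argmaxFrom-∈ : ∀ b xs → argmaxFrom f b xs ∈ b ∷ xs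
  argmaxFrom-∈ b [] = here refl
  argmaxFrom-∈ b (x ∷ xs) with f b <ᵇ f x
  ... | true = there (argmaxFrom-∈ x xs)
  ... | false with argmaxFrom-∈ b xs
  ...   | here best≡b = here best≡b
  ...   | there best∈xs = there (there best∈xs)

  argmax-∈ : ∀ xs {w} → argmax f xs ≡ just w → w ∈ xs
  argmax-∈ (x ∷ xs) refl = argmaxFrom-∈ x xs

  argmaxAfter : Maybe (Fin n) → List (Fin n) → Maybe (Fin n)
  argmaxAfter nothing ys = argmax f ys
  argmaxAfter (just c) ys = just (argmaxFrom f c ys)

  pickAfter : Maybe (Fin n) → Fin n → Fin n
  pickAfter nothing x = x
  pickAfter (just c) x = pick c x

  argmaxAfter-∷ : ∀ m x ys → argmaxAfter m (x ∷ ys) ≡ argmaxAfter (just (pickAfter m x)) ys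
  argmaxAfter-∷ nothing x ys = refl
  argmaxAfter-∷ (just c) x ys = cong just (argmaxFrom-∷ c x ys)

  module _ (v : Fin n) where

    -- Trails b m: b is the running best of a left-to-right scan of a list and
    -- m that of the same scan with every occurrence of v deleted.
    data Trails : Fin n → Maybe (Fin n) → Set where
      at-v     : Trails v nothing
      behind-v : ∀ {c} → f c ≤ f v → Trails v (just c)
      off-v    : ∀ {b} → b ≢ v → Trails b (just b)

    trails-pick-v : ∀ {b m} → Trails b m → Trails (pick b v) m
    trails-pick-v at-v rewrite pick-self v = at-v
    trails-pick-v (behind-v c≤v) rewrite pick-self v = behind-v c≤v
    trails-pick-v (off-v {b} b≢v) with pick-view b v
    ... | picks-new b<v picked rewrite picked = behind-v (<⇒≤ b<v)
    ... | keeps-old _ kept rewrite kept = off-v b≢v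

    trails-pick : ∀ {b m x} → x ≢ v → Trails b m → Trails (pick b x) (just (pickAfter m x))
    trails-pick {x = x} x≢v at-v with pick-view v x
    ... | picks-new _ picked rewrite picked = off-v x≢v
    ... | keeps-old x≤v kept rewrite kept = behind-v x≤v
    trails-pick {x = x} x≢v (behind-v {c} c≤v) with pick-view v x
    ... | picks-new v<x picked rewrite picked | pick-< (≤-<-trans c≤v v<x) = off-v x≢v
    ... | keeps-old x≤v kept rewrite kept with pick-view c x
    ...   | picks-new _ picked′ rewrite picked′ = behind-v x≤v
    ...   | keeps-old _ kept′ rewrite kept′ = behind-v c≤v
    trails-pick {x = x} x≢v (off-v {b} b≢v) with pick-view b x
    ... | picks-new _ picked rewrite picked = off-v x≢v
    ... | keeps-old _ kept rewrite kept = off-v b≢v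

    trails-scan : ∀ {b m} xs → Trails b m →
                  argmaxFrom f b xs ≡ v ⊎ just (argmaxFrom f b xs) ≡ argmaxAfter m (without v xs)
    trails-scan [] at-v = inj₁ refl
    trails-scan [] (behind-v _) = inj₁ refl
    trails-scan [] (off-v _) = inj₂ refl
    trails-scan {b} {m} (x ∷ xs) r with x ≟ v
    ... | yes refl rewrite argmaxFrom-∷ b x xs = trails-scan xs (trails-pick-v r)
    ... | no x≢v rewrite argmaxFrom-∷ b x xs | argmaxAfter-∷ m x (without v xs) =
      trails-scan xs (trails-pick x≢v r)

    argmax-without : ∀ xs → argmax f xs ≡ just v ⊎ argmax f xs ≡ argmax f (without v xs)
    argmax-without [] = inj₂ refl
    argmax-without (x ∷ xs) with x ≟ v
    ... | yes refl = map₁ (cong just) (trails-scan xs at-v)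
    ... | no x≢v = map₁ (cong just) (trails-scan xs (off-v x≢v))

open Argmax using (argmax-∈; argmax-without)

argmaxFrom-cong : ∀ {n} {f g : Fin n → ℕ} b xs → All (λ x → f x ≡ g x) (b ∷ xs) →
                  argmaxFrom f b xs ≡ argmaxFrom g b xs
argmaxFrom-cong b [] _ = refl
argmaxFrom-cong {g = g} b (x ∷ xs) (fb≡gb ∷ fx≡gx ∷ eqs) rewrite fb≡gb | fx≡gx with g b <ᵇ g x
... | true = argmaxFrom-cong x xs (fx≡gx ∷ eqs)
... | false = argmaxFrom-cong b xs (fb≡gb ∷ eqs)

argmax-cong : ∀ {n} {f g : Fin n → ℕ} xs → All (λ x → f x ≡ g x) xs → argmax f xs ≡ argmax g xs
argmax-cong [] _ = refl
argmax-cong (x ∷ xs) eqs = cong just (argmaxFrom-cong x xs eqs)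

module _ {n : ℕ} where

  score : Graph n → List (Fin n) → Fin n → ℕ
  score G T x = path1 G x T

  frontier : Graph n → List (Fin n) → List (Fin n) → List (Fin n)
  frontier G T I = filt (λ x → not (memb x I)) (nbrs G T)

  unvisited : List (Fin n) → ℕ
  unvisited I = length (filt (λ x → not (memb x I)) (allFin n))

  frontier-fresh : ∀ G T I {w} → w ∈ frontier G T I → memb w I ≡ false
  frontier-fresh G T I w∈ =
    trans (sym (not-involutive _)) (cong not (filt-∈ (λ x → not (memb x I)) (nbrs G T) w∈))

  unvisited-≤ : ∀ I → unvisited I ≤ n
  unvisited-≤ I = ≤-trans (filt-length-≤ _ (allFin n)) (≤-reflexive (length-tabulate id))

  unvisited-∷ : ∀ {w} I → memb w I ≡ false → suc (unvisited (w ∷ I)) ≤ unvisited I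
  unvisited-∷ {w} I w∉I =
    filt-length-< (λ x → not (memb x I)) (λ x → not (memb x (w ∷ I))) still-unvisited
      (allFin n) (∈-allFin w) (cong not w∉I) (cong (λ b → not (b ∨ memb w I)) (⌊≟⌋-refl w))
    where
    still-unvisited : ∀ x → not (⌊ x ≟ w ⌋ ∨ memb x I) ≡ true → not (memb x I) ≡ true
    still-unvisited x with ⌊ x ≟ w ⌋
    ... | false = id

  AgreeOff : Fin n → Graph n → Graph n → Set
  AgreeOff v G G' = ∀ x y → x ≢ v → y ≢ v → adj G x y ≡ adj G' x y

  inDplus-agreeOff : ∀ {G G' v} → (∀ u → u ≢ v → ∀ w → inDplus G v u w ≡ inDplus G' v u w) →
                     AgreeOff v G G'
  inDplus-agreeOff {G} {G'} {v} same x y x≢v y≢v = begin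
    adj G x y                  ≡⟨ ∨-identityʳ _ ⟨
    adj G x y ∨ false          ≡⟨ cong (adj G x y ∨_) (⌊≟⌋-≢ y≢v) ⟨
    inDplus G v x y            ≡⟨ same x x≢v y ⟩
    inDplus G' v x y           ≡⟨ cong (adj G' x y ∨_) (⌊≟⌋-≢ y≢v) ⟩
    adj G' x y ∨ false         ≡⟨ ∨-identityʳ _ ⟩
    adj G' x y                 ∎

module _ {n : ℕ} (isT : Fin n → Bool) where

  extendTargets : Fin n → List (Fin n) → List (Fin n)
  extendTargets w T = if isT w then T ++ w ∷ [] else T

  extendTargets-rejected : ∀ {w} T → isT w ≡ false → extendTargets w T ≡ T
  extendTargets-rejected {w} T rejected = cong (if_then T ++ w ∷ [] else T) rejected

  extendTargets-all : ∀ {P : Fin n → Set} {w T} → P w → All P T → All P (extendTargets w T)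
  extendTargets-all {w = w} Pw PT with isT w
  ... | true = ++⁺ PT (Pw ∷ [])
  ... | false = PT

  afterQuery : Graph n → ℕ → List (Fin n) → List (Fin n) → Maybe (Fin n) → List (Fin n)
  afterQuery G k T I nothing = T
  afterQuery G k T I (just w) = sfsLoop isT G k (extendTargets w T) (w ∷ I)

  sfsLoop-suc : ∀ G k T I →
                sfsLoop isT G (suc k) T I ≡ afterQuery G k T I (argmax (score G T) (frontier G T I))
  sfsLoop-suc G k T I with argmax (score G T) (frontier G T I)
  ... | nothing = refl
  ... | just w with isT w
  ...   | true = refl
  ...   | false = refl

  sfsLoop-stuck : ∀ G k T I → argmax (score G T) (frontier G T I) ≡ nothing → sfsLoop isT G k T I ≡ T
  sfsLoop-stuck G zero T I _ = refl
  sfsLoop-stuck G (suc k) T I none = trans (sfsLoop-suc G k T I) (cong (afterQuery G k T I) none)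

  sfsLoop-exhausted : ∀ G k T I → unvisited I ≤ 0 → sfsLoop isT G k T I ≡ T
  sfsLoop-exhausted G k T I exhausted with argmax (score G T) (frontier G T I) in chosen
  ... | nothing = sfsLoop-stuck G k T I chosen
  ... | just w with ≤-trans (unvisited-∷ I (frontier-fresh G T I (argmax-∈ _ _ chosen))) exhausted
  ...   | ()

  module _ (v : Fin n) where

    sfsLoop-cong : ∀ {G G'} → AgreeOff v G G' → ∀ k T I I' → All (_≢ v) T → memb v I ≡ true →
                   (∀ x → memb x I ≡ memb x I') → sfsLoop isT G k T I ≡ sfsLoop isT G' k T I'
    sfsLoop-cong agree zero T I I' v∉T v∈I I≈I' = refl
    sfsLoop-cong {G} {G'} agree (suc k) T I I' v∉T v∈I I≈I' = begin
      sfsLoop isT G (suc k) T I                     ≡⟨ sfsLoop-suc G k T I ⟩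
      afterQuery G k T I (argmax (score G T) C)     ≡⟨ cong (afterQuery G k T I) same-choice ⟩
      afterQuery G k T I (argmax (score G' T) C')   ≡⟨ continue _ refl ⟩
      afterQuery G' k T I' (argmax (score G' T) C') ≡⟨ sfsLoop-suc G' k T I' ⟨
      sfsLoop isT G' (suc k) T I'                   ∎
      where
      C C' : List (Fin n)
      C = frontier G T I
      C' = frontier G' T I'

      off-v : ∀ {w} → memb w I ≡ false → w ≢ v
      off-v w∉I refl = true≢false (trans (sym v∈I) w∉I)

      visited-v : ∀ H J → memb v J ≡ true → (any (adj H v) T ∧ not (memb v J)) ≡ false
      visited-v H J v∈J = trans (cong (λ b → any (adj H v) T ∧ not b) v∈J) (∧-zeroʳ _)

      same-test : ∀ x → (any (adj G x) T ∧ not (memb x I)) ≡ (any (adj G' x) T ∧ not (memb x I'))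
      same-test x with x ≟ v
      ... | yes refl = trans (visited-v G I v∈I) (sym (visited-v G' I' (trans (sym (I≈I' v)) v∈I)))
      ... | no x≢v = cong₂ _∧_ (any-cong T (All.map (agree x _ x≢v) v∉T)) (cong not (I≈I' x))

      same-frontier : C ≡ C'
      same-frontier = begin
        C                                                         ≡⟨ filt-fusion _ _ (allFin n) ⟩
        filt (λ x → any (adj G x) T ∧ not (memb x I)) (allFin n)   ≡⟨ filt-cong (allFin n) (All.universal same-test _) ⟩
        filt (λ x → any (adj G' x) T ∧ not (memb x I')) (allFin n) ≡⟨ filt-fusion _ _ (allFin n) ⟨
        C'                                                        ∎

      same-score : ∀ {x} → x ∈ C' → score G T x ≡ score G' T x
      same-score {x} x∈C' = cong length (filt-cong T (All.map (agree x _ x≢v) v∉T))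
        where
        x≢v : x ≢ v
        x≢v = off-v (trans (I≈I' x) (frontier-fresh G' T I' x∈C'))

      same-choice : argmax (score G T) C ≡ argmax (score G' T) C'
      same-choice = trans (cong (argmax (score G T)) same-frontier) (argmax-cong C' (All.tabulate same-score))

      continue : ∀ m → argmax (score G' T) C' ≡ m → afterQuery G k T I m ≡ afterQuery G' k T I' m
      continue nothing _ = refl
      continue (just w) chosen =
        sfsLoop-cong agree k (extendTargets w T) (w ∷ I) (w ∷ I') (extendTargets-all (off-v w∉I) v∉T)
          (trans (cong (⌊ v ≟ w ⌋ ∨_) v∈I) (∨-zeroʳ _)) (λ x → cong (⌊ x ≟ w ⌋ ∨_) (I≈I' x))
        where
        w∉I : memb w I ≡ false
        w∉I = trans (I≈I' w) (frontier-fresh G' T I' (argmax-∈ _ C' chosen))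

    sfsLoop-skip-v : isT v ≡ false → ∀ G k T I J → (∀ x → memb x J ≡ (⌊ x ≟ v ⌋ ∨ memb x I)) →
                     All (_≢ v) T → unvisited I ≤ k → sfsLoop isT G (suc k) T I ≡ sfsLoop isT G k T J
    sfsLoop-skip-v _ G zero T I J _ _ exhausted = sfsLoop-exhausted G 1 T I exhausted
    sfsLoop-skip-v v-rejected G (suc k) T I J J≈v∷I v∉T fuel =
      trans (sfsLoop-suc G (suc k) T I) (follow (argmax-without (score G T) v C))
      where
      f : Fin n → ℕ
      f = score G T
      C : List (Fin n)
      C = frontier G T I

      frontier-J : without v C ≡ frontier G T J
      frontier-J = begin
        without v C                                            ≡⟨ filt-fusion _ _ (nbrs G T) ⟩
        filt (λ x → not (memb x I) ∧ not ⌊ x ≟ v ⌋) (nbrs G T) ≡⟨ filt-cong (nbrs G T) (All.universal test _) ⟩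
        frontier G T J                                         ∎
        where
        test : ∀ x → (not (memb x I) ∧ not ⌊ x ≟ v ⌋) ≡ not (memb x J)
        test x = trans (sym (not-∨ ⌊ x ≟ v ⌋ (memb x I))) (cong not (sym (J≈v∷I x)))

      fresh-in-J : ∀ {w} → memb w J ≡ false → w ≢ v × memb w I ≡ false
      fresh-in-J {w} w∉J with w ≟ v | trans (sym (J≈v∷I w)) w∉J
      ... | no w≢v | w∉I = w≢v , w∉I

      resume : ∀ m → argmax f (frontier G T J) ≡ m → afterQuery G (suc k) T I m ≡ sfsLoop isT G (suc k) T J
      resume nothing none = sym (sfsLoop-stuck G (suc k) T J none)
      resume (just w) chosen with fresh-in-J (frontier-fresh G T J (argmax-∈ _ _ chosen))
      ... | w≢v , w∉I = begin
        sfsLoop isT G (suc k) (extendTargets w T) (w ∷ I)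
          ≡⟨ sfsLoop-skip-v v-rejected G k _ (w ∷ I) (w ∷ J) w∷J≈v∷w∷I (extendTargets-all w≢v v∉T)
               (≤-pred (≤-trans (unvisited-∷ I w∉I) fuel)) ⟩
        sfsLoop isT G k (extendTargets w T) (w ∷ J)
          ≡⟨ trans (sfsLoop-suc G k T J) (cong (afterQuery G k T J) chosen) ⟨
        sfsLoop isT G (suc k) T J ∎
        where
        w∷J≈v∷w∷I : ∀ x → memb x (w ∷ J) ≡ (⌊ x ≟ v ⌋ ∨ memb x (w ∷ I))
        w∷J≈v∷w∷I x = trans (cong (⌊ x ≟ w ⌋ ∨_) (J≈v∷I x)) (∨-leftComm ⌊ x ≟ w ⌋ ⌊ x ≟ v ⌋ (memb x I))

      follow : argmax f C ≡ just v ⊎ argmax f C ≡ argmax f (without v C) →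
               afterQuery G (suc k) T I (argmax f C) ≡ sfsLoop isT G (suc k) T J
      follow (inj₁ v-chosen) = begin
        afterQuery G (suc k) T I (argmax f C)
          ≡⟨ cong (afterQuery G (suc k) T I) v-chosen ⟩
        sfsLoop isT G (suc k) (extendTargets v T) (v ∷ I)
          ≡⟨ cong (λ T' → sfsLoop isT G (suc k) T' (v ∷ I)) (extendTargets-rejected T v-rejected) ⟩
        sfsLoop isT G (suc k) T (v ∷ I)
          ≡⟨ sfsLoop-cong (λ _ _ _ _ → refl) (suc k) T (v ∷ I) J v∉T
               (cong (_∨ memb v I) (⌊≟⌋-refl v)) (λ x → sym (J≈v∷I x)) ⟩
        sfsLoop isT G (suc k) T J ∎
      follow (inj₂ v-ignored) =
        trans (cong (afterQuery G (suc k) T I) (trans v-ignored (cong (argmax f) frontier-J)))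
              (resume _ refl)

lemma7 : (n : ℕ) (isT : Fin n → Bool) (t : Fin n) → isT t ≡ true →
         (G G' : Graph n) → Neighboring isT G G' →
         SFS isT G t ≡ SFS isT G' t
lemma7 zero _ ()
lemma7 (suc m) isT t t∈T G G' (v , v-rejected , nbr) = begin
  SFS isT G t               ≡⟨ sfsLoop-skip-v isT v v-rejected G m _ _ _ (λ _ → refl) v∉t∷[] fuel ⟩
  sfsLoop isT G m t∷[] v∷t  ≡⟨ sfsLoop-cong isT v agree m _ _ _ v∉t∷[] v∈v∷t (λ _ → refl) ⟩
  sfsLoop isT G' m t∷[] v∷t ≡⟨ sfsLoop-skip-v isT v v-rejected G' m _ _ _ (λ _ → refl) v∉t∷[] fuel ⟨
  SFS isT G' t              ∎
  where
  t∷[] v∷t : List (Fin (suc m))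
  t∷[] = t ∷ []
  v∷t = v ∷ t∷[]
  agree : AgreeOff v G G'
  agree = inDplus-agreeOff {G = G} {G'} nbr
  v∉t∷[] : All (_≢ v) t∷[]
  v∉t∷[] = (λ { refl → true≢false (trans (sym t∈T) v-rejected) }) ∷ []
  v∈v∷t : memb v v∷t ≡ true
  v∈v∷t = cong (_∨ memb v t∷[]) (⌊≟⌋-refl v)
  fuel : unvisited t∷[] ≤ m
  fuel = ≤-pred (≤-trans (unvisited-∷ {w = t} [] refl) (unvisited-≤ {n = suc m} []))
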